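{- Let $n\geqslant1$ and let $c\in\mathfrak{S}_{n+1}$ be a Coxeter element. The map $\Phi_c$ is a bijection from the set $\mathcal{ST}(c)$ of $c$-storable $n$-tuples of integer partitions onto the set $\operatorname{RPP}(\boldsymbol{\lambda}(c))$ of reverse plane partitions of shape $\boldsymbol{\lambda}(c)$.
   Context: Coxeter elements: with $s_i=(i,i+1)$, a Coxeter element of $\mathfrak{S}_{n+1}$ is a product $s_{\sigma(1)}\cdots s_{\sigma(n)}$ for a permutation $\sigma$ of $\{1,\dots,n\}$; it is uniquely a cycle $(c_1,\dots,c_m,c_{m+1},\dots,c_{n+1})$ with $1=c_1<\dots<c_m=n+1>c_{m+1}>\dots>c_{n+1}>1$; $L_c=\{c_2,\dots,c_{m-1}\}$, $R_c=\{c_{m+1},\dots,c_{n+1}\}$. Writing $L_c\cup\{1\}=\{a_1<\dots<a_p\}$, the partition $\boldsymbol{\lambda}(c)$ has parts $\boldsymbol{\lambda}(c)_i=\#\{r\in R_c\cup\{n+1\}:a_i<r\}$; it satisfies $\boldsymbol{\lambda}(c)_1+\ell(\boldsymbol{\lambda}(c))-1=n$. Partitions, diagrams: partitions are infinite weakly decreasing sequences of nonnegative integers with finitely many nonzero terms; $\operatorname{Fer}(\lambda)=\{(i,j):1\leqslant i\leqslant\ell(\lambda),1\leqslant j\leqslant\lambda_i\}$. A reverse plane partition of shape $\lambda$ is $f:\operatorname{Fer}(\lambda)\to\mathbb{N}$ with $f(i,j)\leqslant f(i',j')$ whenever $i\leqslant i'$, $j\leqslant j'$. For $k\in\{1,\dots,n\}$,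 $D_k(\lambda)=\{(i,j)\in\operatorname{Fer}(\lambda):\lambda_1+i-j=k\}$, $\delta_k=\max\{\min(i,j):(i,j)\in D_k(\lambda)\}$, and the box $(i,j)\in D_k(\lambda)$ has diagonal coordinates $\langle k,\delta\rangle$ with $\delta=\delta_k-\min(i,j)+1$ (a bijection $D_k(\lambda)\to\{1,\dots,\delta_k\}$). Storability: a pair $(\lambda,\mu)$ is storable if $\lambda_i\geqslant\mu_i\geqslant\lambda_{i+1}$ for all $i\geqslant1$. Let $L=L_c\cup\{1\}$, $R=R_c\cup\{n+1\}$, $R[-1]=\{r-1:r\in R\}$. For an $n$-tuple $\boldsymbol{\pi}=(\pi^1,\dots,\pi^n)$ of partitions put $\pi^0=\pi^{n+1}=(0)$. Then $\boldsymbol{\pi}$ is $c$-storable if for each $i\in\{1,\dots,n\}$: (a) if $i\notin L\cup R[-1]$, $(\pi^{i-1},\pi^i)$ and $(\pi^{i+1},\pi^i)$ are storable; (b) if $i\in R[-1]\setminus L$, $(\pi^{i-1},\pi^i)$ and $(\pi^i,\pi^{i+1})$ are storable; (c) if $i\in L\setminus R[-1]$, $(\pi^i,\pi^{i-1})$ and $(\pi^{i+1},\pi^i)$ are storable; (d) if $i\in L\cap R[-1]$, $(\pi^i,\pi^{i-1})$ and $(\pi^i,\pi^{i+1})$ are storable; (e) $\pi^k=(0)$ for $k\notin\{\min L,\dots,\max R\}$. The map: $\Phi_c(\boldsymbol{\pi})$ is the filling of $\boldsymbol{\lambda}(c)$ whose value at the box with diagonal coordinates $\langle k,\delta\rangle$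 is $\pi^k_\delta$ (the $\delta$-th part of $\pi^k$, zero if $\delta>\ell(\pi^k)$). -}

module Defs where

open import Data.Nat using (ℕ; zero; suc; _+_; _∸_; _≤_; _<_; _⊓_; _⊔_; _≡ᵇ_; _≤ᵇ_; _<ᵇ_; _<?_)
open import Data.Bool using (Bool; true; false; _∧_; _∨_; not)
open import Data.Fin using (Fin; toℕ; fromℕ<; inject₁)
import Data.Fin as F
open import Data.Fin.Permutation using (Permutation′; _⟨$⟩ʳ_; transpose; _∘ₚ_; _≈_)
import Data.Fin.Permutation as P
open import Data.List using (List; []; _∷_; length; map; foldr; filterᵇ; upTo; allFin; concatMap; applyUpTo)
open import Data.List.Relation.Unary.All using (All)
open import Data.List.Relation.Unary.Linked using (Linked)
open import Data.Vec using (Vec; toList)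
open import Data.Product using (Σ; _×_; _,_)
open import Relation.Binary.PropositionalEquality using (_≡_)
open import Relation.Nullary using (yes; no; ¬_)

-- A partition is encoded by the finite list of its nonzero parts
-- (λ₁, λ₂, …, λ_ℓ), weakly decreasing and positive; all further parts are 0.
IsPartition : List ℕ → Set
IsPartition xs = Linked (λ a b → b ≤ a) xs × All (λ a → 1 ≤ a) xs

len : List ℕ → ℕ
len = length

lookup0 : List ℕ → ℕ → ℕ
lookup0 []       _       = 0
lookup0 (x ∷ xs) zero    = x
lookup0 (x ∷ xs) (suc k) = lookup0 xs k

-- λ ‼ i  is the i-th part λ_i (1-indexed, i ≥ 1); zero when i > ℓ(λ)
_‼_ : List ℕ → ℕ → ℕ
xs ‼ i = lookup0 xs (i ∸ 1)

InFer : List ℕ → ℕ → ℕ → Set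
InFer lam i j = 1 ≤ i × i ≤ len lam × 1 ≤ j × j ≤ lam ‼ i

ferList : List ℕ → List (ℕ × ℕ)
ferList lam = concatMap (λ i → applyUpTo (λ j → (i , suc j)) (lam ‼ i))
                        (applyUpTo suc (len lam))

-- Reverse plane partitions of shape λ (a filling is any f : ℕ → ℕ → ℕ,
-- only its values on Fer(λ) matter)
IsRPP : List ℕ → (ℕ → ℕ → ℕ) → Set
IsRPP lam f = ∀ i j i′ j′ → InFer lam i j → InFer lam i′ j′ →
              i ≤ i′ → j ≤ j′ → f i j ≤ f i′ j′

Storable : List ℕ → List ℕ → Set
Storable lam mu = ∀ i → 1 ≤ i → (mu ‼ i ≤ lam ‼ i) × (lam ‼ (suc i) ≤ mu ‼ i)

-- Coxeter elements of 𝔖_{n+1} (acting on Fin (n+1) = {1,…,n+1} shifted by 1)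

-- s_{i+1} = (i+1, i+2) for i : Fin n
simpleTr : ∀ {n} → Fin n → Permutation′ (suc n)
simpleTr i = transpose (inject₁ i) (F.suc i)

prodPerm : ∀ {m} → List (Permutation′ m) → Permutation′ m
prodPerm []       = P.id
prodPerm (p ∷ ps) = p ∘ₚ prodPerm ps

coxProd : ∀ {n} → Permutation′ n → Permutation′ (suc n)
coxProd {n} σ = prodPerm (map (λ k → simpleTr (σ ⟨$⟩ʳ k)) (allFin n))

IsCoxeter : ∀ n → Permutation′ (suc n) → Set
IsCoxeter n c = Σ (Permutation′ n) (λ σ → c ≈ coxProd σ)

-- c viewed on labels {1,…,n+1}:  cval c j = c(j)
cval : ∀ {n} → Permutation′ (suc n) → ℕ → ℕ
cval c zero = zero
cval {n} c (suc k) with k <? suc n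
... | yes p = suc (toℕ (c ⟨$⟩ʳ fromℕ< p))
... | no  _ = suc k

-- j ∈ L = L_c ∪ {1}: L_c = {j ∈ {2,…,n} : c(j) > j}
-- (in the cycle (c_1,…,c_{n+1}), c maps c_t to c_{t+1})
inL : ∀ n → Permutation′ (suc n) → ℕ → Bool
inL n c j = (j ≡ᵇ 1) ∨ ((2 ≤ᵇ j) ∧ (j ≤ᵇ n) ∧ (j <ᵇ cval c j))

inR : ∀ n → Permutation′ (suc n) → ℕ → Bool
inR n c j = (j ≡ᵇ suc n) ∨ ((2 ≤ᵇ j) ∧ (j ≤ᵇ n) ∧ not (j <ᵇ cval c j))

Llist : ∀ n → Permutation′ (suc n) → List ℕ
Llist n c = filterᵇ (inL n c) (applyUpTo suc n)

Rlist : ∀ n → Permutation′ (suc n) → List ℕ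
Rlist n c = filterᵇ (inR n c) (applyUpTo suc (suc n))

count : (ℕ → Bool) → List ℕ → ℕ
count p xs = length (filterᵇ p xs)

lamC : ∀ n → Permutation′ (suc n) → List ℕ
lamC n c = map (λ a → count (λ r → a <ᵇ r) (Rlist n c)) (Llist n c)

minL : ∀ n → Permutation′ (suc n) → ℕ
minL n c = foldr _⊓_ (suc n) (Llist n c)

maxR : ∀ n → Permutation′ (suc n) → ℕ
maxR n c = foldr _⊔_ 0 (Rlist n c)

-- π^k for k ∈ {0,…,n+1}, with π^0 = π^{n+1} = (0)
comp : ∀ {n} → Vec (List ℕ) n → ℕ → List ℕ
comp π zero    = []
comp π (suc m) = nth (toList π) m
  where
  nth : List (List ℕ) → ℕ → List ℕ
  nth []       _       = []
  nth (x ∷ xs) zero    = x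
  nth (x ∷ xs) (suc k) = nth xs k

CStorable : ∀ n → Permutation′ (suc n) → Vec (List ℕ) n → Set
CStorable n c π =
  All IsPartition (toList π) ×
  (∀ i → 1 ≤ i → i ≤ n →
     let iL  = inL n c i ; iR = inR n c (suc i)
         p₋ = comp π (i ∸ 1) ; p = comp π i ; p₊ = comp π (suc i) in
     (iL ≡ false → iR ≡ false → Storable p₋ p × Storable p₊ p) ×
     (iL ≡ false → iR ≡ true  → Storable p₋ p × Storable p p₊) ×
     (iL ≡ true  → iR ≡ false → Storable p p₋ × Storable p₊ p) ×
     (iL ≡ true  → iR ≡ true  → Storable p p₋ × Storable p p₊)) ×
  (∀ k → 1 ≤ k → k ≤ n → ¬ (minL n c ≤ k × k ≤ maxR n c) → comp π k ≡ [])

diagIdx : List ℕ → ℕ → ℕ → ℕ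
diagIdx lam i j = (lam ‼ 1 + i) ∸ j

deltaK : List ℕ → ℕ → ℕ
deltaK lam k = foldr _⊔_ 0
  (map (λ b → Data.Product.proj₁ b ⊓ Data.Product.proj₂ b)
       (filterᵇ (λ b → diagIdx lam (Data.Product.proj₁ b) (Data.Product.proj₂ b) ≡ᵇ k)
                (ferList lam)))

diagDelta : List ℕ → ℕ → ℕ → ℕ
diagDelta lam i j = (deltaK lam (diagIdx lam i j) ∸ (i ⊓ j)) + 1

Phi : ∀ n → Permutation′ (suc n) → Vec (List ℕ) n → ℕ → ℕ → ℕ
Phi n c π i j = comp π (diagIdx (lamC n c) i j) ‼ diagDelta (lamC n c) i j

-- Let A k be the number of elements of L in {1,…,k} and B k the number of
-- elements of R in {k+1,…,n+1}.  As k runs from 0 to n+1, each step either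
-- raises A by one (k+1 ∈ L) or lowers B by one (k+1 ∈ R), and
-- A k + B 0 = B k + k.  The k-th diagonal of λ(c) consists of the boxes
-- (A k − t, B k − t) for t < min (A k) (B k), and the box (A k − t, B k − t)
-- has diagonal coordinates ⟨k, t+1⟩; so Φ_c(π) carries the parts of π^k
-- along the k-th diagonal, starting from its corner (A k, B k).
-- The orientation of the storability condition between π^k and π^(k+1) is
-- decided by whether k+1 ∈ R, and in either orientation its two inequalities
-- are exactly the RPP inequalities between neighbouring boxes of the
-- diagonals k and k+1.  Storability also bounds ℓ(π^k) by min (A k) (B k),
-- so π is recovered from Φ_c(π) by reading the filling along the diagonals,
-- and this reading is the inverse map.
module Submission where

open import Data.Bool using (Bool; true; false; not; T)
open import Data.Bool.Properties using (not-involutive; T-≡)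
open import Data.Empty using (⊥-elim)
open import Data.Fin.Permutation using (Permutation′)
open import Data.List using (List; []; _∷_; [_]; _++_; length; map; foldr; filterᵇ; applyUpTo)
open import Data.List.Properties using (applyUpTo-∷ʳ; filter-++; length-++; length-map; ++-identityʳ)
open import Data.List.Membership.Propositional using (_∈_)
open import Data.List.Membership.Propositional.Properties
  using (∈-map⁺; ∈-map⁻; ∈-filter⁺; ∈-filter⁻; ∈-applyUpTo⁺; ∈-applyUpTo⁻; ∈-concatMap⁺; ∈-concatMap⁻)
open import Data.List.Relation.Unary.All as All using (All; []; _∷_)
open import Data.List.Relation.Unary.Any using (here; there)
open import Data.List.Relation.Unary.Any.Properties using (applyUpTo⁺; applyUpTo⁻)
open import Data.List.Relation.Unary.Linked using (Linked; []; [-]; _∷_)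
open import Data.Nat
  using (ℕ; zero; suc; _+_; _∸_; _≤_; _<_; _≤′_; ≤′-refl; ≤′-step; _⊓_; _⊔_; _≡ᵇ_; _<ᵇ_; z≤n; s≤s; s≤s⁻¹; _≤?_; _<?_)
open import Data.Nat.Properties
open import Data.Nat.Tactic.RingSolver using (solve-∀)
open import Data.Product using (Σ; _×_; _,_; proj₁; proj₂)
open import Data.Sum using (inj₁; inj₂)
open import Data.Vec using (Vec; toList) renaming ([] to []ᵥ; _∷_ to _∷ᵥ_)
open import Function using (_∘_; Equivalence)
open import Relation.Binary.PropositionalEquality hiding ([_])
open import Relation.Nullary using (yes; no; ¬_; contradiction)
open import Relation.Nullary.Decidable using (T?)

open import Defs

private
  variable
    i j k t : ℕ
    μ ν : List ℕ

Positive : List ℕ → Set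
Positive = All (1 ≤_)

lookup0-++ˡ : ∀ xs ys {i} → i < length xs → lookup0 (xs ++ ys) i ≡ lookup0 xs i
lookup0-++ˡ (x ∷ xs) ys {zero}  _   = refl
lookup0-++ˡ (x ∷ xs) ys {suc i} i<n = lookup0-++ˡ xs ys (s≤s⁻¹ i<n)

lookup0-++-length : ∀ xs y ys → lookup0 (xs ++ y ∷ ys) (length xs) ≡ y
lookup0-++-length []       y ys = refl
lookup0-++-length (x ∷ xs) y ys = lookup0-++-length xs y ys

lookup0-map : ∀ (h : ℕ → ℕ) xs {i} → i < length xs → lookup0 (map h xs) i ≡ h (lookup0 xs i)
lookup0-map h (x ∷ xs) {zero}  _   = refl
lookup0-map h (x ∷ xs) {suc i} i<n = lookup0-map h xs (s≤s⁻¹ i<n)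

length≤⇒lookup0≡0 : ∀ xs {i} → length xs ≤ i → lookup0 xs i ≡ 0
length≤⇒lookup0≡0 []       _        = refl
length≤⇒lookup0≡0 (x ∷ xs) {suc i} ℓ≤i = length≤⇒lookup0≡0 xs (s≤s⁻¹ ℓ≤i)

lookup0≡0⇒length≤ : ∀ {xs} → Positive xs → ∀ i → lookup0 xs i ≡ 0 → length xs ≤ i
lookup0≡0⇒length≤ []           i       _  = z≤n
lookup0≡0⇒length≤ (x>0 ∷ _)    zero    x≡0 = contradiction (sym x≡0) (<⇒≢ x>0)
lookup0≡0⇒length≤ (_ ∷ xs>0)   (suc i) eq = s≤s (lookup0≡0⇒length≤ xs>0 i eq)

lookup0-injective : ∀ {xs ys} → Positive xs → Positive ys →
                    (∀ t → lookup0 xs t ≡ lookup0 ys t) → xs ≡ ys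
lookup0-injective []          []          _  = refl
lookup0-injective []          (y>0 ∷ _)   eq = contradiction (eq 0) (<⇒≢ y>0)
lookup0-injective (x>0 ∷ _)   []          eq = contradiction (sym (eq 0)) (<⇒≢ x>0)
lookup0-injective (_ ∷ xs>0)  (_ ∷ ys>0)  eq =
  cong₂ _∷_ (eq 0) (lookup0-injective xs>0 ys>0 (eq ∘ suc))

lookup0-antitone⇒Linked : ∀ xs → (∀ t → lookup0 xs (suc t) ≤ lookup0 xs t) → Linked (λ a b → b ≤ a) xs
lookup0-antitone⇒Linked []           _    = []
lookup0-antitone⇒Linked (x ∷ [])     _    = [-]
lookup0-antitone⇒Linked (x ∷ y ∷ xs) anti = anti 0 ∷ lookup0-antitone⇒Linked (y ∷ xs) (anti ∘ suc)

foldr-⊔-lub : ∀ {m} xs → All (_≤ m) xs → foldr _⊔_ 0 xs ≤ m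
foldr-⊔-lub []       []            = z≤n
foldr-⊔-lub (x ∷ xs) (x≤m ∷ xs≤m) = ⊔-lub x≤m (foldr-⊔-lub xs xs≤m)

∈⇒≤foldr-⊔ : ∀ {x xs} → x ∈ xs → x ≤ foldr _⊔_ 0 xs
∈⇒≤foldr-⊔ {xs = x ∷ xs} (here refl) = m≤m⊔n x _
∈⇒≤foldr-⊔ {xs = y ∷ xs} (there x∈) = ≤-trans (∈⇒≤foldr-⊔ x∈) (m≤n⊔m y _)

common-offset : ∀ {a b i j} → a + j ≡ b + i → i ≤ a → Σ ℕ λ t → i + t ≡ a × j + t ≡ b
common-offset {a} {b} {i} {j} eq i≤a = a ∸ i , m+[n∸m]≡n i≤a , +-cancelʳ-≡ i _ _ (begin
  j + (a ∸ i) + i   ≡⟨ +-assoc j (a ∸ i) i ⟩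
  j + (a ∸ i + i)   ≡⟨ cong (j +_) (m∸n+n≡m i≤a) ⟩
  j + a             ≡⟨ +-comm j a ⟩
  a + j             ≡⟨ eq ⟩
  b + i             ∎)
  where open ≡-Reasoning

+-cross : ∀ {a b x y i j} → a + x ≡ b + y → y + j ≡ x + i → a + j ≡ b + i
+-cross {a} {b} {x} {y} {i} {j} ax≡by yj≡xi = +-cancelʳ-≡ x _ _ (begin
  a + j + x     ≡⟨ swap a j x ⟩
  a + x + j     ≡⟨ cong (_+ j) ax≡by ⟩
  b + y + j     ≡⟨ +-assoc b y j ⟩
  b + (y + j)   ≡⟨ cong (b +_) yj≡xi ⟩
  b + (x + i)   ≡⟨ swap′ b x i ⟩
  b + i + x     ∎)
  where
  open ≡-Reasoning
  swap : ∀ a j x → a + j + x ≡ a + x + j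
  swap = solve-∀
  swap′ : ∀ b x i → b + (x + i) ≡ b + i + x
  swap′ = solve-∀

-- Counting in {1,…,m}

filter≤ : (ℕ → Bool) → ℕ → List ℕ
filter≤ P m = filterᵇ P (applyUpTo suc m)

count≤ : (ℕ → Bool) → ℕ → ℕ
count≤ P m = length (filter≤ P m)

filter≤-suc : ∀ P m → filter≤ P (suc m) ≡ filter≤ P m ++ filterᵇ P [ suc m ]
filter≤-suc P m = trans (cong (filterᵇ P) (sym (applyUpTo-∷ʳ suc m)))
                        (filter-++ (T? ∘ P) (applyUpTo suc m) [ suc m ])

filter≤-suc-true : ∀ P m → P (suc m) ≡ true → filter≤ P (suc m) ≡ filter≤ P m ++ [ suc m ]
filter≤-suc-true P m Pm rewrite filter≤-suc P m | Pm = refl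

filter≤-suc-false : ∀ P m → P (suc m) ≡ false → filter≤ P (suc m) ≡ filter≤ P m
filter≤-suc-false P m Pm rewrite filter≤-suc P m | Pm = ++-identityʳ (filter≤ P m)

count≤-suc-true : ∀ P m → P (suc m) ≡ true → count≤ P (suc m) ≡ suc (count≤ P m)
count≤-suc-true P m Pm =
  trans (cong length (filter≤-suc-true P m Pm)) (trans (length-++ (filter≤ P m)) (+-comm _ 1))

count≤-suc-false : ∀ P m → P (suc m) ≡ false → count≤ P (suc m) ≡ count≤ P m
count≤-suc-false P m Pm = cong length (filter≤-suc-false P m Pm)

count≤-≤-suc : ∀ P m → count≤ P m ≤ count≤ P (suc m)
count≤-≤-suc P m with P (suc m) in Pm
... | true  = ≤-trans (n≤1+n _) (≤-reflexive (sym (count≤-suc-true P m Pm)))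
... | false = ≤-reflexive (sym (count≤-suc-false P m Pm))

count≤-mono : ∀ P {k m} → k ≤ m → count≤ P k ≤ count≤ P m
count≤-mono P {m = zero} z≤n = ≤-refl
count≤-mono P {m = suc m} k≤1+m with m≤n⇒m<n∨m≡n k≤1+m
... | inj₂ refl  = ≤-refl
... | inj₁ k<1+m = ≤-trans (count≤-mono P (s≤s⁻¹ k<1+m)) (count≤-≤-suc P m)

count-++ : ∀ p xs ys → count p (xs ++ ys) ≡ count p xs + count p ys
count-++ p xs ys = trans (cong length (filter-++ (T? ∘ p) xs ys)) (length-++ (filterᵇ p xs))

count-<ᵇ-filter≤ : ∀ P k m → count (k <ᵇ_) (filter≤ P m) ≡ count≤ P m ∸ count≤ P k
count-<ᵇ-filter≤ P k zero = sym (0∸n≡0 (count≤ P k))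
count-<ᵇ-filter≤ P k (suc m) with P (suc m) in Pm
... | false = begin
  count (k <ᵇ_) (filter≤ P (suc m))  ≡⟨ cong (count (k <ᵇ_)) (filter≤-suc-false P m Pm) ⟩
  count (k <ᵇ_) (filter≤ P m)        ≡⟨ count-<ᵇ-filter≤ P k m ⟩
  count≤ P m ∸ count≤ P k            ≡⟨ cong (_∸ count≤ P k) (count≤-suc-false P m Pm) ⟨
  count≤ P (suc m) ∸ count≤ P k      ∎
  where open ≡-Reasoning
... | true = begin
  count (k <ᵇ_) (filter≤ P (suc m))
    ≡⟨ cong (count (k <ᵇ_)) (filter≤-suc-true P m Pm) ⟩
  count (k <ᵇ_) (filter≤ P m ++ [ suc m ])
    ≡⟨ count-++ (k <ᵇ_) (filter≤ P m) [ suc m ] ⟩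
  count (k <ᵇ_) (filter≤ P m) + count (k <ᵇ_) [ suc m ]
    ≡⟨ cong (_+ count (k <ᵇ_) [ suc m ]) (count-<ᵇ-filter≤ P k m) ⟩
  count≤ P m ∸ count≤ P k + count (k <ᵇ_) [ suc m ]
    ≡⟨ new-label ⟩
  suc (count≤ P m) ∸ count≤ P k
    ≡⟨ cong (_∸ count≤ P k) (count≤-suc-true P m Pm) ⟨
  count≤ P (suc m) ∸ count≤ P k
    ∎
  where
  open ≡-Reasoning
  new-label : count≤ P m ∸ count≤ P k + count (k <ᵇ_) [ suc m ] ≡ suc (count≤ P m) ∸ count≤ P k
  new-label with k <ᵇ suc m in k<m
  ... | true  = trans (+-comm _ 1) (sym (+-∸-assoc 1 (count≤-mono P k≤m)))
    where
    k≤m : k ≤ m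
    k≤m = s≤s⁻¹ (<ᵇ⇒< k (suc m) (Equivalence.from T-≡ k<m))
  ... | false =
    trans (+-identityʳ _) (trans (m≤n⇒m∸n≡0 (≤-trans (n≤1+n _) m+1≤k)) (sym (m≤n⇒m∸n≡0 m+1≤k)))
    where
    k≮m+1 : ¬ k < suc m
    k≮m+1 k<m+1 = subst T k<m (<⇒<ᵇ k<m+1)
    m+1≤k : suc (count≤ P m) ≤ count≤ P k
    m+1≤k = subst (_≤ count≤ P k) (count≤-suc-true P m Pm) (count≤-mono P (≮⇒≥ k≮m+1))

lookup0-filter≤ : ∀ P m {i} → i < count≤ P m →
  Σ ℕ λ e → e < m × P (suc e) ≡ true × count≤ P e ≡ i × lookup0 (filter≤ P m) i ≡ suc e
lookup0-filter≤ P (suc m) {i} i<c with P (suc m) in Pm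
... | false with lookup0-filter≤ P m (subst (i <_) (count≤-suc-false P m Pm) i<c)
...   | e , e<m , Pe , ce , look =
  e , m<n⇒m<1+n e<m , Pe , ce , trans (cong (λ xs → lookup0 xs i) (filter≤-suc-false P m Pm)) look
lookup0-filter≤ P (suc m) {i} i<c | true with i <? count≤ P m
... | yes i<c′ with lookup0-filter≤ P m i<c′
...   | e , e<m , Pe , ce , look =
  e , m<n⇒m<1+n e<m , Pe , ce ,
  trans (cong (λ xs → lookup0 xs i) (filter≤-suc-true P m Pm))
        (trans (lookup0-++ˡ (filter≤ P m) _ i<c′) look)
lookup0-filter≤ P (suc m) {i} i<c | true | no i≮c′ =
  m , ≤-refl , Pm , sym i≡c ,
  trans (cong (λ xs → lookup0 xs i) (filter≤-suc-true P m Pm))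
        (subst (λ x → lookup0 (filter≤ P m ++ [ suc m ]) x ≡ suc m) (sym i≡c)
               (lookup0-++-length (filter≤ P m) (suc m) []))
  where
  i≡c : i ≡ count≤ P m
  i≡c = ≤-antisym (s≤s⁻¹ (subst (i <_) (count≤-suc-true P m Pm) i<c)) (≮⇒≥ i≮c′)

-- Partitions from antitone sequences

AntitoneBelow : ℕ → (ℕ → ℕ) → Set
AntitoneBelow d v = ∀ {s t} → s ≤ t → t < d → v t ≤ v s

positivePrefix : (ℕ → ℕ) → ℕ → List ℕ
positivePrefix v zero    = []
positivePrefix v (suc d) with v 0
... | zero  = []
... | suc x = suc x ∷ positivePrefix (v ∘ suc) d

positivePrefix-length≤ : ∀ v d → length (positivePrefix v d) ≤ d
positivePrefix-length≤ v zero = z≤n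
positivePrefix-length≤ v (suc d) with v 0
... | zero  = z≤n
... | suc x = s≤s (positivePrefix-length≤ (v ∘ suc) d)

positivePrefix-Positive : ∀ v d → Positive (positivePrefix v d)
positivePrefix-Positive v zero = []
positivePrefix-Positive v (suc d) with v 0
... | zero  = []
... | suc x = s≤s z≤n ∷ positivePrefix-Positive (v ∘ suc) d

positivePrefix-lookup : ∀ v d → AntitoneBelow d v → ∀ {t} → t < d →
                        lookup0 (positivePrefix v d) t ≡ v t
positivePrefix-lookup v (suc d) anti {zero} _ with v 0
... | zero  = refl
... | suc x = refl
positivePrefix-lookup v (suc d) anti {suc t} t<d with v 0 in v0
... | zero  = sym (n≤0⇒n≡0 (subst (v (suc t) ≤_) v0 (anti z≤n t<d)))
... | suc x = positivePrefix-lookup (v ∘ suc) d (λ s≤t t<d → anti (s≤s s≤t) (s≤s t<d)) (s≤s⁻¹ t<d)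

positivePrefix-beyond : ∀ v d → d ≤ t → lookup0 (positivePrefix v d) t ≡ 0
positivePrefix-beyond v d d≤t =
  length≤⇒lookup0≡0 (positivePrefix v d) (≤-trans (positivePrefix-length≤ v d) d≤t)

positivePrefix-IsPartition : ∀ v d → AntitoneBelow d v → IsPartition (positivePrefix v d)
positivePrefix-IsPartition v d anti =
  lookup0-antitone⇒Linked (positivePrefix v d) decreasing , positivePrefix-Positive v d
  where
  decreasing : ∀ t → lookup0 (positivePrefix v d) (suc t) ≤ lookup0 (positivePrefix v d) t
  decreasing t with suc t <? d
  ... | yes t+1<d = subst₂ _≤_ (sym (positivePrefix-lookup v d anti t+1<d))
                               (sym (positivePrefix-lookup v d anti (<⇒≤ t+1<d)))
                               (anti (n≤1+n t) t+1<d)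
  ... | no t+1≮d rewrite positivePrefix-beyond v d (≮⇒≥ t+1≮d) = z≤n

Storable⇒length≤ : Positive ν → Storable μ ν → length ν ≤ length μ
Storable⇒length≤ {ν} {μ} ν>0 st = lookup0≡0⇒length≤ ν>0 (length μ)
  (n≤0⇒n≡0 (≤-trans (proj₁ (st (suc (length μ)) (s≤s z≤n)))
                    (≤-reflexive (length≤⇒lookup0≡0 μ ≤-refl))))

Storable⇒length≤suc : Positive μ → Storable μ ν → length μ ≤ suc (length ν)
Storable⇒length≤suc {μ} {ν} μ>0 st = lookup0≡0⇒length≤ μ>0 (suc (length ν))
  (n≤0⇒n≡0 (≤-trans (proj₂ (st (suc (length ν)) (s≤s z≤n)))
                    (≤-reflexive (length≤⇒lookup0≡0 ν ≤-refl))))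

StorableEdge : Bool → List ℕ → List ℕ → Set
StorableEdge true  μ ν = Storable μ ν
StorableEdge false μ ν = Storable ν μ

-- If the box at depth t′ from the corner (a′, b′) exists, so does the one at depth t
-- from (a, b), and the former lies weakly above and to the left of the latter.
Box≤ : ℕ → ℕ → ℕ → ℕ → ℕ → ℕ → Set
Box≤ a′ b′ t′ a b t = t′ < a′ ⊓ b′ → t < a ⊓ b × a′ ∸ t′ ≤ a ∸ t × b′ ∸ t′ ≤ b ∸ t

Box≤-left : ∀ a b t → Box≤ a b t a (suc b) t
Box≤-left a b t t<d = <-≤-trans t<d (⊓-monoʳ-≤ a (n≤1+n b)) , ≤-refl , ∸-monoˡ-≤ t (n≤1+n b)

Box≤-up : ∀ a b t → Box≤ a b t (suc a) b t
Box≤-up a b t t<d = <-≤-trans t<d (⊓-monoˡ-≤ b (n≤1+n a)) , ∸-monoˡ-≤ t (n≤1+n a) , ≤-refl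

Box≤-left-deeper : ∀ a b t → Box≤ (suc a) b (suc t) a b t
Box≤-left-deeper a b t t<d =
  ⊓-glb (s≤s⁻¹ (≤-trans t<d (m⊓n≤m _ _))) (≤-trans (n≤1+n _) (≤-trans t<d (m⊓n≤n _ _))) ,
  ≤-refl , ∸-monoʳ-≤ b (n≤1+n t)

Box≤-up-deeper : ∀ a b t → Box≤ a (suc b) (suc t) a b t
Box≤-up-deeper a b t t<d =
  ⊓-glb (≤-trans (n≤1+n _) (≤-trans t<d (m⊓n≤m _ _))) (s≤s⁻¹ (≤-trans t<d (m⊓n≤n _ _))) ,
  ∸-monoʳ-≤ a (n≤1+n t) , ≤-refl

-- Ferrers diagrams

∈ferList⇒InFer : ∀ lam {i j} → (i , j) ∈ ferList lam → InFer lam i j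
∈ferList⇒InFer lam ij∈
  with applyUpTo⁻ suc (∈-concatMap⁻ (λ i → applyUpTo (λ j → (i , suc j)) (lam ‼ i))
                                    {xs = applyUpTo suc (len lam)} ij∈)
... | i , i<ℓ , ij∈row with ∈-applyUpTo⁻ (λ j → (suc i , suc j)) ij∈row
...   | j , j<λ , refl = s≤s z≤n , i<ℓ , s≤s z≤n , j<λ

InFer⇒∈ferList : ∀ lam {i j} → InFer lam i j → (i , j) ∈ ferList lam
InFer⇒∈ferList lam {suc i} {suc j} (_ , i<ℓ , _ , j<λ) =
  ∈-concatMap⁺ (λ i → applyUpTo (λ j → (i , suc j)) (lam ‼ i))
    (applyUpTo⁺ suc (∈-applyUpTo⁺ (λ j → (suc i , suc j)) j<λ) i<ℓ)

deltaK-≤ : ∀ lam k {m} → (∀ {i j} → InFer lam i j → diagIdx lam i j ≡ k → i ⊓ j ≤ m) → deltaK lam k ≤ m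
deltaK-≤ lam k {m} bound = foldr-⊔-lub _ (All.tabulate bounded)
  where
  onDiagonalᵇ : ℕ × ℕ → Bool
  onDiagonalᵇ b = diagIdx lam (proj₁ b) (proj₂ b) ≡ᵇ k
  bounded : ∀ {x} → x ∈ map (λ b → proj₁ b ⊓ proj₂ b) (filterᵇ onDiagonalᵇ (ferList lam)) → x ≤ m
  bounded x∈ with ∈-map⁻ _ x∈
  ... | (i , j) , ij∈ , refl with ∈-filter⁻ (T? ∘ onDiagonalᵇ) ij∈
  ...   | ij∈Fer , on = bound (∈ferList⇒InFer lam ij∈Fer) (≡ᵇ⇒≡ _ k on)

≤-deltaK : ∀ lam {i j} → InFer lam i j → i ⊓ j ≤ deltaK lam (diagIdx lam i j)
≤-deltaK lam {i} {j} fer = ∈⇒≤foldr-⊔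
  (∈-map⁺ _ (∈-filter⁺ (T? ∘ λ b → diagIdx lam (proj₁ b) (proj₂ b) ≡ᵇ diagIdx lam i j)
                       (InFer⇒∈ferList lam fer) (≡⇒≡ᵇ (diagIdx lam i j) _ refl)))

DownClosed : List ℕ → Set
DownClosed lam = ∀ {i j i′ j′} → InFer lam i′ j′ → 1 ≤ i → i ≤ i′ → 1 ≤ j → j ≤ j′ → InFer lam i j

stepwise⇒IsRPP : ∀ {lam} {f : ℕ → ℕ → ℕ} → DownClosed lam →
  (∀ {i j} → 1 ≤ i → InFer lam (suc i) j → f i j ≤ f (suc i) j) →
  (∀ {i j} → 1 ≤ j → InFer lam i (suc j) → f i j ≤ f i (suc j)) →
  IsRPP lam f
stepwise⇒IsRPP {lam} {f} closed down right i j i′ j′ (i≥1 , _ , j≥1 , _) fer′ i≤i′ j≤j′ =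
  ≤-trans (column (≤⇒≤′ i≤i′) (closed fer′ (≤-trans i≥1 i≤i′) ≤-refl j≥1 j≤j′))
          (row (≤⇒≤′ j≤j′) fer′)
  where
  column : ∀ {i″} → i ≤′ i″ → InFer lam i″ j → f i j ≤ f i″ j
  column ≤′-refl _ = ≤-refl
  column (≤′-step i≤i″) fer@(_ , _ , j≥1 , _) =
    ≤-trans (column i≤i″ (closed fer i≥1+ (n≤1+n _) j≥1 ≤-refl)) (down i≥1+ fer)
    where i≥1+ = ≤-trans i≥1 (≤′⇒≤ i≤i″)
  row : ∀ {j″} → j ≤′ j″ → InFer lam i′ j″ → f i′ j ≤ f i′ j″
  row ≤′-refl _ = ≤-refl
  row (≤′-step j≤j″) fer@(i′≥1 , _ , _ , _) =
    ≤-trans (row j≤j″ (closed fer i′≥1 ≤-refl j≥1+ (n≤1+n _))) (right j≥1+ fer)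
    where j≥1+ = ≤-trans j≥1 (≤′⇒≤ j≤j″)

comp-last : ∀ {n} (π : Vec (List ℕ) n) → comp π (suc n) ≡ []
comp-last []ᵥ      = refl
comp-last (_ ∷ᵥ π) = comp-last π

comp-Positive : ∀ {n} (π : Vec (List ℕ) n) → All IsPartition (toList π) →
                ∀ k → Positive (comp π k)
comp-Positive π        _              zero          = []
comp-Positive []ᵥ      _              (suc k)       = []
comp-Positive (_ ∷ᵥ π) ((_ , p) ∷ _)  (suc zero)    = p
comp-Positive (_ ∷ᵥ π) (_ ∷ parts)    (suc (suc k)) = comp-Positive π parts (suc k)

comp-injective : ∀ {n} {π π′ : Vec (List ℕ) n} →
                 (∀ k → 1 ≤ k → k ≤ n → comp π k ≡ comp π′ k) → π ≡ π′
comp-injective {π = []ᵥ}     {[]ᵥ}      _  = refl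
comp-injective {π = x ∷ᵥ π} {x′ ∷ᵥ π′} eq = cong₂ _∷ᵥ_ (eq 1 ≤-refl (s≤s z≤n))
  (comp-injective λ { (suc k) _ k<n → eq (suc (suc k)) (s≤s z≤n) (s≤s k<n) })

fromComps : (ℕ → List ℕ) → (n : ℕ) → Vec (List ℕ) n
fromComps G zero    = []ᵥ
fromComps G (suc n) = G 1 ∷ᵥ fromComps (G ∘ suc) n

comp-fromComps : ∀ G n {k} → 1 ≤ k → k ≤ n → comp (fromComps G n) k ≡ G k
comp-fromComps G (suc n) {suc zero}    _ _   = refl
comp-fromComps G (suc n) {suc (suc k)} _ k<n = comp-fromComps (G ∘ suc) n (s≤s z≤n) (s≤s⁻¹ k<n)

fromComps-All : ∀ {P : List ℕ → Set} G n → (∀ k → 1 ≤ k → k ≤ n → P (G k)) →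
                All P (toList (fromComps G n))
fromComps-All G zero    _  = []
fromComps-All G (suc n) PG = PG 1 ≤-refl (s≤s z≤n) ∷ fromComps-All (G ∘ suc) n
  (λ { (suc k) _ k≤n → PG (suc (suc k)) (s≤s z≤n) (s≤s k≤n) })

-- Read in order, the labels 1,…,N+1 trace the boundary of λ: each label in L
-- is a row and each label in R a column of its Ferrers diagram.
module LatticePath (N : ℕ) (L R : ℕ → Bool)
  (L-first : L 1 ≡ true) (R-last : R (suc N) ≡ true)
  (L≡not-R : ∀ {j} → 1 ≤ j → j ≤ suc N → L j ≡ not (R j)) where

  A B : ℕ → ℕ
  A k = count≤ L k
  B k = count (k <ᵇ_) (filter≤ R (suc N))

  lam : List ℕ
  lam = map B (filter≤ L N)

  B-count : ∀ k → B k ≡ count≤ R (suc N) ∸ count≤ R k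
  B-count k = count-<ᵇ-filter≤ R k (suc N)

  A-mono : ∀ {k k′} → k ≤ k′ → A k ≤ A k′
  A-mono = count≤-mono L

  B-antitone : ∀ {k k′} → k ≤ k′ → B k′ ≤ B k
  B-antitone {k} {k′} k≤k′ = subst₂ _≤_ (sym (B-count k′)) (sym (B-count k))
                                      (∸-monoʳ-≤ (count≤ R (suc N)) (count≤-mono R k≤k′))

  B-vanishes : suc N ≤ k → B k ≡ 0
  B-vanishes {k} N<k = trans (B-count k) (m≤n⇒m∸n≡0 (count≤-mono R N<k))

  B-positive⇒≤N : 1 ≤ B k → k ≤ N
  B-positive⇒≤N {k} B>0 with k ≤? N
  ... | yes k≤N = k≤N
  ... | no  k≰N = contradiction (sym (B-vanishes (≰⇒> k≰N))) (<⇒≢ B>0)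

  data Step (k : ℕ) : Bool → Set where
    R-step : A (suc k) ≡ A k → B k ≡ suc (B (suc k)) → Step k true
    L-step : A (suc k) ≡ suc (A k) → B (suc k) ≡ B k → Step k false

  L-opposite : k ≤ N → ∀ {b} → R (suc k) ≡ b → L (suc k) ≡ not b
  L-opposite k≤N Rk = trans (L≡not-R (s≤s z≤n) (s≤s k≤N)) (cong not Rk)

  B-suc-R : k ≤ N → R (suc k) ≡ true → B k ≡ suc (B (suc k))
  B-suc-R {k} k≤N Rk = begin
    B k                                  ≡⟨ B-count k ⟩
    total ∸ count≤ R k                   ≡⟨ +-∸-assoc 1 (subst (_≤ total) counted (count≤-mono R (s≤s k≤N))) ⟩
    suc (total ∸ suc (count≤ R k))       ≡⟨ cong (λ x → suc (total ∸ x)) counted ⟨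
    suc (total ∸ count≤ R (suc k))       ≡⟨ cong suc (B-count (suc k)) ⟨
    suc (B (suc k))                      ∎
    where
    open ≡-Reasoning
    total = count≤ R (suc N)
    counted : count≤ R (suc k) ≡ suc (count≤ R k)
    counted = count≤-suc-true R k Rk

  B-suc-L : R (suc k) ≡ false → B (suc k) ≡ B k
  B-suc-L {k} Rk = begin
    B (suc k)                             ≡⟨ B-count (suc k) ⟩
    count≤ R (suc N) ∸ count≤ R (suc k)   ≡⟨ cong (count≤ R (suc N) ∸_) (count≤-suc-false R k Rk) ⟩
    count≤ R (suc N) ∸ count≤ R k         ≡⟨ B-count k ⟨
    B k                                   ∎
    where open ≡-Reasoning

  step : k ≤ N → Step k (R (suc k))
  step {k} k≤N with R (suc k) in Rk
  ... | true  = R-step (count≤-suc-false L k (L-opposite k≤N Rk)) (B-suc-R k≤N Rk)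
  ... | false = L-step (count≤-suc-true L k (L-opposite k≤N Rk)) (B-suc-L Rk)

  last-step : Step N true
  last-step = subst (Step N) R-last (step ≤-refl)

  B-last : B N ≡ 1
  B-last with last-step
  ... | R-step _ B-drops = trans B-drops (cong suc (B-vanishes ≤-refl))

  A-last : A (suc N) ≡ A N
  A-last with last-step
  ... | R-step A-stays _ = A-stays

  A₁≡1 : A 1 ≡ 1
  A₁≡1 = count≤-suc-true L 0 L-first

  B₁≡B₀ : B 1 ≡ B 0
  B₁≡B₀ = first-step (step z≤n)
    where
    first-step : ∀ {b} → Step 0 b → B 1 ≡ B 0
    first-step (R-step A-stays _) = contradiction (trans (sym A₁≡1) A-stays) λ ()
    first-step (L-step _ B-stays) = B-stays

  A+B₀≡B+k : k ≤ suc N → A k + B 0 ≡ B k + k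
  A+B₀≡B+k {zero}  _   = sym (+-identityʳ (B 0))
  A+B₀≡B+k {suc k} k<N = next (step (s≤s⁻¹ k<N)) (A+B₀≡B+k (≤-trans (n≤1+n k) k<N))
    where
    open ≡-Reasoning
    next : ∀ {b} → Step k b → A k + B 0 ≡ B k + k → A (suc k) + B 0 ≡ B (suc k) + suc k
    next (R-step A-stays B-drops) balanced = begin
      A (suc k) + B 0     ≡⟨ cong (_+ B 0) A-stays ⟩
      A k + B 0           ≡⟨ balanced ⟩
      B k + k             ≡⟨ cong (_+ k) B-drops ⟩
      suc (B (suc k)) + k ≡⟨ +-suc (B (suc k)) k ⟨
      B (suc k) + suc k   ∎
    next (L-step A-rises B-stays) balanced = begin
      A (suc k) + B 0     ≡⟨ cong (_+ B 0) A-rises ⟩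
      suc (A k + B 0)     ≡⟨ cong suc balanced ⟩
      suc (B k + k)       ≡⟨ +-suc (B k) k ⟨
      B k + suc k         ≡⟨ cong (_+ suc k) B-stays ⟨
      B (suc k) + suc k   ∎

  length-lam : length lam ≡ A N
  length-lam = length-map B (filter≤ L N)

  row : ∀ {i} → 1 ≤ i → i ≤ A N →
        Σ ℕ λ e → e ≤ N × A e ≡ i × (∀ {k} → i ≤ A k → e ≤ k) × lam ‼ i ≡ B e
  row {suc i} _ i<A with lookup0-filter≤ L N i<A
  ... | e , e<N , Le , Ae≡i , look =
    suc e , e<N , trans (count≤-suc-true L e Le) (cong suc Ae≡i) , first ,
    trans (lookup0-map B (filter≤ L N) i<A) (cong B look)
    where
    first : ∀ {k} → suc i ≤ A k → suc e ≤ k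
    first {k} i<Ak = ≰⇒> λ k≤e → 1+n≰n (≤-trans i<Ak (≤-trans (A-mono k≤e) (≤-reflexive Ae≡i)))

  ∈Fer⇒under-corner : InFer lam i j → Σ ℕ λ e → e ≤ N × i ≤ A e × j ≤ B e
  ∈Fer⇒under-corner {i} {j} (i≥1 , i≤ℓ , _ , j≤λi) with row i≥1 (subst (i ≤_) length-lam i≤ℓ)
  ... | e , e≤N , Ae≡i , _ , λi≡Be = e , e≤N , ≤-reflexive (sym Ae≡i) , subst (j ≤_) λi≡Be j≤λi

  under-corner⇒∈Fer : 1 ≤ i → 1 ≤ j → k ≤ N → i ≤ A k → j ≤ B k → InFer lam i j
  under-corner⇒∈Fer {i} {j} i≥1 j≥1 k≤N i≤A j≤B =
    i≥1 , subst (i ≤_) (sym length-lam) i≤AN , j≥1 , j≤λi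
    where
    i≤AN : i ≤ A N
    i≤AN = ≤-trans i≤A (A-mono k≤N)
    j≤λi : j ≤ lam ‼ i
    j≤λi with row i≥1 i≤AN
    ... | e , _ , _ , first , λi≡Be = subst (j ≤_) (sym λi≡Be) (≤-trans j≤B (B-antitone (first i≤A)))

  InFer-downClosed : DownClosed lam
  InFer-downClosed fer i≥1 i≤i′ j≥1 j≤j′ with ∈Fer⇒under-corner fer
  ... | e , e≤N , i′≤A , j′≤B = under-corner⇒∈Fer i≥1 j≥1 e≤N (≤-trans i≤i′ i′≤A) (≤-trans j≤j′ j′≤B)

  A-N-positive : 1 ≤ A N
  A-N-positive = begin
    1         ≡⟨ A₁≡1 ⟨
    A 1       ≤⟨ A-mono {1} {suc N} (s≤s z≤n) ⟩
    A (suc N) ≡⟨ A-last ⟩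
    A N       ∎
    where open ≤-Reasoning

  λ₁≡B₀ : lam ‼ 1 ≡ B 0
  λ₁≡B₀ with row ≤-refl A-N-positive
  ... | zero        , _ , () , _     , _
  ... | suc zero    , _ , _  , _     , λ₁≡B₁ = trans λ₁≡B₁ B₁≡B₀
  ... | suc (suc e) , _ , _  , first , _     =
    contradiction (first {1} (≤-reflexive (sym A₁≡1))) λ { (s≤s ()) }

  record OnDiagonal (k t i j : ℕ) : Set where
    constructor onDiagonal
    field
      i+t≡A : i + t ≡ A k
      j+t≡B : j + t ≡ B k

  onDiagonal⇒balanced : OnDiagonal k t i j → B k + i ≡ A k + j
  onDiagonal⇒balanced {k} {t} {i} {j} (onDiagonal i+t≡A j+t≡B) = begin
    B k + i    ≡⟨ cong (_+ i) j+t≡B ⟨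
    j + t + i  ≡⟨ exchange j t i ⟩
    i + t + j  ≡⟨ cong (_+ j) i+t≡A ⟩
    A k + j    ∎
    where
    open ≡-Reasoning
    exchange : ∀ j t i → j + t + i ≡ i + t + j
    exchange = solve-∀

  diagIdx-onDiagonal : k ≤ suc N → OnDiagonal k t i j → diagIdx lam i j ≡ k
  diagIdx-onDiagonal {k} {t} {i} {j} k≤N+1 on = begin
    lam ‼ 1 + i ∸ j  ≡⟨ cong (λ x → x + i ∸ j) λ₁≡B₀ ⟩
    B 0 + i ∸ j      ≡⟨ cong (_∸ j) B₀+i≡k+j ⟩
    k + j ∸ j        ≡⟨ m+n∸n≡m k j ⟩
    k                ∎
    where
    open ≡-Reasoning
    B₀+A≡k+B : B 0 + A k ≡ k + B k
    B₀+A≡k+B = trans (+-comm (B 0) (A k)) (trans (A+B₀≡B+k k≤N+1) (+-comm (B k) k))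
    B₀+i≡k+j : B 0 + i ≡ k + j
    B₀+i≡k+j = +-cross {B 0} {k} {A k} {B k} B₀+A≡k+B (onDiagonal⇒balanced on)

  diagIdx+j≡B₀+i : j ≤ B 0 → diagIdx lam i j + j ≡ B 0 + i
  diagIdx+j≡B₀+i {j = j} {i = i} j≤B₀ =
    trans (cong (λ x → x + i ∸ j + j) λ₁≡B₀) (m∸n+n≡m (≤-trans j≤B₀ (m≤m+n (B 0) i)))

  ∈Fer⇒onDiagonal : InFer lam i j →
                    diagIdx lam i j ≤ N × Σ ℕ (λ t → OnDiagonal (diagIdx lam i j) t i j)
  ∈Fer⇒onDiagonal {i} {j} fer@(_ , _ , j≥1 , _) with ∈Fer⇒under-corner fer
  ... | e , e≤N , i≤Ae , j≤Be = κ≤N , offset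
    where
    κ = diagIdx lam i j
    κ+j≡B₀+i : κ + j ≡ B 0 + i
    κ+j≡B₀+i = diagIdx+j≡B₀+i (≤-trans j≤Be (B-antitone z≤n))
    κ≤N : κ ≤ N
    κ≤N = s≤s⁻¹ (begin
      suc κ      ≡⟨ +-comm 1 κ ⟩
      κ + 1      ≤⟨ +-monoʳ-≤ κ j≥1 ⟩
      κ + j      ≡⟨ κ+j≡B₀+i ⟩
      B 0 + i    ≤⟨ +-monoʳ-≤ (B 0) (≤-trans i≤Ae (A-mono e≤N)) ⟩
      B 0 + A N  ≡⟨ +-comm (B 0) (A N) ⟩
      A N + B 0  ≡⟨ A+B₀≡B+k (n≤1+n N) ⟩
      B N + N    ≡⟨ cong (_+ N) B-last ⟩
      suc N      ∎)
      where open ≤-Reasoning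
    balanced : A κ + j ≡ B κ + i
    balanced = +-cross {A κ} {B κ} {B 0} {κ} (A+B₀≡B+k (≤-trans κ≤N (n≤1+n N))) κ+j≡B₀+i
    offset : Σ ℕ (λ t → OnDiagonal κ t i j)
    offset with e ≤? κ
    ... | yes e≤κ with common-offset {A κ} {B κ} balanced (≤-trans i≤Ae (A-mono e≤κ))
    ...   | t , i+t≡A , j+t≡B = t , onDiagonal i+t≡A j+t≡B
    offset | no e≰κ
      with common-offset {B κ} {A κ} (sym balanced) (≤-trans j≤Be (B-antitone (<⇒≤ (≰⇒> e≰κ))))
    ...   | t , j+t≡B , i+t≡A = t , onDiagonal i+t≡A j+t≡B

  deltaK-corner : k ≤ N → 1 ≤ A k → 1 ≤ B k → deltaK lam k ≡ A k ⊓ B k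
  deltaK-corner {k} k≤N A>0 B>0 = ≤-antisym (deltaK-≤ lam k bound)
    (subst (λ x → A k ⊓ B k ≤ deltaK lam x) (diagIdx-onDiagonal (≤-trans k≤N (n≤1+n N)) corner)
           (≤-deltaK lam (under-corner⇒∈Fer A>0 B>0 k≤N ≤-refl ≤-refl)))
    where
    corner : OnDiagonal k 0 (A k) (B k)
    corner = onDiagonal (+-identityʳ (A k)) (+-identityʳ (B k))
    bound : ∀ {i j} → InFer lam i j → diagIdx lam i j ≡ k → i ⊓ j ≤ A k ⊓ B k
    bound {i} {j} fer idx≡k with ∈Fer⇒onDiagonal fer
    ... | _ , t , onDiagonal i+t≡A j+t≡B = subst (λ x → i ⊓ j ≤ A x ⊓ B x) idx≡k
      (⊓-mono-≤ (subst (i ≤_) i+t≡A (m≤m+n i t)) (subst (j ≤_) j+t≡B (m≤m+n j t)))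

  -- t is one less than the paper's second diagonal coordinate δ.
  onDiagonal⇒coordinates : 1 ≤ i → 1 ≤ j → OnDiagonal k t i j →
                           InFer lam i j × diagIdx lam i j ≡ k × diagDelta lam i j ≡ suc t
  onDiagonal⇒coordinates {i} {j} {k} {t} i≥1 j≥1 on@(onDiagonal i+t≡A j+t≡B) = fer , idx , delta
    where
    i≤A : i ≤ A k
    i≤A = subst (i ≤_) i+t≡A (m≤m+n i t)
    j≤B : j ≤ B k
    j≤B = subst (j ≤_) j+t≡B (m≤m+n j t)
    k≤N : k ≤ N
    k≤N = B-positive⇒≤N (≤-trans j≥1 j≤B)
    fer = under-corner⇒∈Fer i≥1 j≥1 k≤N i≤A j≤B
    idx = diagIdx-onDiagonal (≤-trans k≤N (n≤1+n N)) on
    open ≡-Reasoning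
    delta : diagDelta lam i j ≡ suc t
    delta = begin
      deltaK lam (diagIdx lam i j) ∸ i ⊓ j + 1
        ≡⟨ cong (λ x → deltaK lam x ∸ i ⊓ j + 1) idx ⟩
      deltaK lam k ∸ i ⊓ j + 1
        ≡⟨ cong (λ x → x ∸ i ⊓ j + 1) (deltaK-corner k≤N (≤-trans i≥1 i≤A) (≤-trans j≥1 j≤B)) ⟩
      A k ⊓ B k ∸ i ⊓ j + 1
        ≡⟨ cong (λ x → x ∸ i ⊓ j + 1) (cong₂ _⊓_ (sym i+t≡A) (sym j+t≡B)) ⟩
      (i + t) ⊓ (j + t) ∸ i ⊓ j + 1
        ≡⟨ cong (λ x → x ∸ i ⊓ j + 1) (+-distribʳ-⊓ t i j) ⟨
      i ⊓ j + t ∸ i ⊓ j + 1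
        ≡⟨ cong (_+ 1) (m+n∸m≡n (i ⊓ j) t) ⟩
      t + 1
        ≡⟨ +-comm t 1 ⟩
      suc t
        ∎

  diagonal-box : t < A k ⊓ B k → 1 ≤ A k ∸ t × 1 ≤ B k ∸ t × OnDiagonal k t (A k ∸ t) (B k ∸ t)
  diagonal-box t<d =
    m<n⇒0<n∸m t<A , m<n⇒0<n∸m t<B , onDiagonal (m∸n+n≡m (<⇒≤ t<A)) (m∸n+n≡m (<⇒≤ t<B))
    where
    t<A = ≤-trans t<d (m⊓n≤m _ _)
    t<B = ≤-trans t<d (m⊓n≤n _ _)

  Φ : Vec (List ℕ) N → ℕ → ℕ → ℕ
  Φ π i j = comp π (diagIdx lam i j) ‼ diagDelta lam i j

  Φ-onDiagonal : ∀ π → 1 ≤ i → 1 ≤ j → OnDiagonal k t i j → Φ π i j ≡ comp π k ‼ suc t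
  Φ-onDiagonal π i≥1 j≥1 on with onDiagonal⇒coordinates i≥1 j≥1 on
  ... | _ , idx , delta = cong₂ (λ k δ → comp π k ‼ δ) idx delta

  StorableAlong : Vec (List ℕ) N → Set
  StorableAlong π = ∀ k → k ≤ N → StorableEdge (R (suc k)) (comp π k) (comp π (suc k))

  module _ {π : Vec (List ℕ) N} (storable : StorableAlong π) where

    -- The left neighbour of the box ⟨k, t+1⟩ is ⟨k+1, t+1⟩ if k+1 ∈ R and ⟨k+1, t+2⟩ if
    -- k+1 ∈ L; its upper neighbour is ⟨k−1, t+2⟩ if k ∈ R and ⟨k−1, t+1⟩ if k ∈ L.  In each
    -- case the inequality is one half of the storability of the edge between the two diagonals.
    Φ-left : k ≤ N → 1 ≤ i → 1 ≤ j → OnDiagonal k t i (suc j) → Φ π i j ≤ comp π k ‼ suc t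
    Φ-left {k} {i} {j} {t} k≤N i≥1 j≥1 (onDiagonal i+t≡A j+t≡B) = by-step (step k≤N) (storable k k≤N)
      where
      open ≤-Reasoning
      by-step : ∀ {b} → Step k b → StorableEdge b (comp π k) (comp π (suc k)) →
                Φ π i j ≤ comp π k ‼ suc t
      by-step (R-step A-stays B-drops) st = begin
        Φ π i j                 ≡⟨ Φ-onDiagonal π i≥1 j≥1 (onDiagonal (trans i+t≡A (sym A-stays))
                                                                       (suc-injective (trans j+t≡B B-drops))) ⟩
        comp π (suc k) ‼ suc t  ≤⟨ proj₁ (st (suc t) (s≤s z≤n)) ⟩
        comp π k ‼ suc t        ∎
      by-step (L-step A-rises B-stays) st = begin
        Φ π i j                       ≡⟨ Φ-onDiagonal π i≥1 j≥1
                                           (onDiagonal (trans (+-suc i t) (trans (cong suc i+t≡A) (sym A-rises)))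
                                                       (trans (+-suc j t) (trans j+t≡B (sym B-stays)))) ⟩
        comp π (suc k) ‼ suc (suc t)  ≤⟨ proj₂ (st (suc t) (s≤s z≤n)) ⟩
        comp π k ‼ suc t              ∎

    Φ-up : k ≤ N → 1 ≤ i → 1 ≤ j → OnDiagonal k t (suc i) j → Φ π i j ≤ comp π k ‼ suc t
    Φ-up {zero}  _   _   _   (onDiagonal () _)
    Φ-up {suc k} {i} {j} {t} k<N i≥1 j≥1 (onDiagonal i+t≡A j+t≡B) =
      by-step (step (<⇒≤ k<N)) (storable k (<⇒≤ k<N))
      where
      open ≤-Reasoning
      by-step : ∀ {b} → Step k b → StorableEdge b (comp π k) (comp π (suc k)) →
                Φ π i j ≤ comp π (suc k) ‼ suc t
      by-step (R-step A-stays B-drops) st = begin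
        Φ π i j                 ≡⟨ Φ-onDiagonal π i≥1 j≥1
                                     (onDiagonal (trans (+-suc i t) (trans i+t≡A A-stays))
                                                 (trans (+-suc j t) (trans (cong suc j+t≡B) (sym B-drops)))) ⟩
        comp π k ‼ suc (suc t)  ≤⟨ proj₂ (st (suc t) (s≤s z≤n)) ⟩
        comp π (suc k) ‼ suc t  ∎
      by-step (L-step A-rises B-stays) st = begin
        Φ π i j                 ≡⟨ Φ-onDiagonal π i≥1 j≥1 (onDiagonal (suc-injective (trans i+t≡A A-rises))
                                                                       (trans j+t≡B B-stays)) ⟩
        comp π k ‼ suc t        ≤⟨ proj₁ (st (suc t) (s≤s z≤n)) ⟩
        comp π (suc k) ‼ suc t  ∎

    Φ-IsRPP : IsRPP lam (Φ π)
    Φ-IsRPP = stepwise⇒IsRPP {lam} {Φ π} InFer-downClosed down right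
      where
      down : 1 ≤ i → InFer lam (suc i) j → Φ π i j ≤ Φ π (suc i) j
      down i≥1 fer@(_ , _ , j≥1 , _) with ∈Fer⇒onDiagonal fer
      ... | k≤N , t , on =
        ≤-trans (Φ-up k≤N i≥1 j≥1 on) (≤-reflexive (sym (Φ-onDiagonal π (s≤s z≤n) j≥1 on)))
      right : 1 ≤ j → InFer lam i (suc j) → Φ π i j ≤ Φ π i (suc j)
      right j≥1 fer@(i≥1 , _ , _ , _) with ∈Fer⇒onDiagonal fer
      ... | k≤N , t , on =
        ≤-trans (Φ-left k≤N i≥1 j≥1 on) (≤-reflexive (sym (Φ-onDiagonal π i≥1 (s≤s z≤n) on)))

    module _ (positive : ∀ k → Positive (comp π k)) where

      length≤A : k ≤ suc N → length (comp π k) ≤ A k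
      length≤A {zero}  _   = z≤n
      length≤A {suc k} k<N = by-step (step (s≤s⁻¹ k<N)) (storable k (s≤s⁻¹ k<N))
        where
        IH : length (comp π k) ≤ A k
        IH = length≤A (≤-trans (n≤1+n k) k<N)
        by-step : ∀ {b} → Step k b → StorableEdge b (comp π k) (comp π (suc k)) →
                  length (comp π (suc k)) ≤ A (suc k)
        by-step (R-step A-stays _) st =
          ≤-trans (Storable⇒length≤ {μ = comp π k} (positive (suc k)) st)
                  (≤-trans IH (≤-reflexive (sym A-stays)))
        by-step (L-step A-rises _) st =
          ≤-trans (Storable⇒length≤suc {ν = comp π k} (positive (suc k)) st)
                  (≤-trans (s≤s IH) (≤-reflexive (sym A-rises)))

      length≤B : ∀ d {k} → d + k ≡ suc N → length (comp π k) ≤ B k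
      length≤B zero    refl = subst (λ x → length x ≤ B (suc N)) (sym (comp-last π)) z≤n
      length≤B (suc d) {k} d+k≡ = by-step (step k≤N) (storable k k≤N)
        where
        k≤N : k ≤ N
        k≤N = subst (k ≤_) (suc-injective d+k≡) (m≤n+m k d)
        IH : length (comp π (suc k)) ≤ B (suc k)
        IH = length≤B d (trans (+-suc d k) d+k≡)
        by-step : ∀ {b} → Step k b → StorableEdge b (comp π k) (comp π (suc k)) →
                  length (comp π k) ≤ B k
        by-step (R-step _ B-drops) st =
          ≤-trans (Storable⇒length≤suc {ν = comp π (suc k)} (positive k) st)
                  (≤-trans (s≤s IH) (≤-reflexive (sym B-drops)))
        by-step (L-step _ B-stays) st =
          ≤-trans (Storable⇒length≤ {μ = comp π (suc k)} (positive k) st)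
                  (≤-trans IH (≤-reflexive B-stays))

      length≤A⊓B : k ≤ N → length (comp π k) ≤ A k ⊓ B k
      length≤A⊓B {k} k≤N = ⊓-glb (length≤A (≤-trans k≤N (n≤1+n N)))
                                  (length≤B (suc N ∸ k) (m∸n+n≡m (≤-trans k≤N (n≤1+n N))))

  Φ-injective : ∀ {π π′} → All IsPartition (toList π) → All IsPartition (toList π′) →
                StorableAlong π → StorableAlong π′ →
                (∀ i j → InFer lam i j → Φ π i j ≡ Φ π′ i j) → π ≡ π′
  Φ-injective {π} {π′} parts parts′ storable storable′ Φ≡ = comp-injective λ k _ k≤N →
    lookup0-injective (comp-Positive π parts k) (comp-Positive π′ parts′ k) (same k≤N)
    where
    same : k ≤ N → ∀ t → lookup0 (comp π k) t ≡ lookup0 (comp π′ k) t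
    same {k} k≤N t with t <? A k ⊓ B k
    ... | yes t<d = let i≥1 , j≥1 , on = diagonal-box t<d in
      trans (sym (Φ-onDiagonal π i≥1 j≥1 on))
            (trans (Φ≡ _ _ (proj₁ (onDiagonal⇒coordinates i≥1 j≥1 on))) (Φ-onDiagonal π′ i≥1 j≥1 on))
    ... | no  t≮d = trans (vanishes storable parts) (sym (vanishes storable′ parts′))
      where
      vanishes : ∀ {ρ} → StorableAlong ρ → All IsPartition (toList ρ) → lookup0 (comp ρ k) t ≡ 0
      vanishes {ρ} st parts = length≤⇒lookup0≡0 (comp ρ k)
        (≤-trans (length≤A⊓B st (comp-Positive ρ parts) k≤N) (≮⇒≥ t≮d))

  module Diagonals (f : ℕ → ℕ → ℕ) (rpp : IsRPP lam f) where

    values : ℕ → ℕ → ℕ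
    values k t = f (A k ∸ t) (B k ∸ t)

    diagonal : ℕ → List ℕ
    diagonal k = positivePrefix (values k) (A k ⊓ B k)

    box∈Fer : t < A k ⊓ B k → InFer lam (A k ∸ t) (B k ∸ t)
    box∈Fer t<d = let i≥1 , j≥1 , on = diagonal-box t<d in proj₁ (onDiagonal⇒coordinates i≥1 j≥1 on)

    values-antitone : ∀ k → AntitoneBelow (A k ⊓ B k) (values k)
    values-antitone k s≤t t<d = rpp _ _ _ _ (box∈Fer t<d) (box∈Fer (≤-<-trans s≤t t<d))
                                     (∸-monoʳ-≤ (A k) s≤t) (∸-monoʳ-≤ (B k) s≤t)

    diagonal-lookup : t < A k ⊓ B k → diagonal k ‼ suc t ≡ values k t
    diagonal-lookup {k = k} = positivePrefix-lookup (values k) (A k ⊓ B k) (values-antitone k)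

    diagonal-≤ : ∀ {k k′ t t′} → Box≤ (A k′) (B k′) t′ (A k) (B k) t →
                 diagonal k′ ‼ suc t′ ≤ diagonal k ‼ suc t
    diagonal-≤ {k} {k′} {t} {t′} below with t′ <? A k′ ⊓ B k′
    ... | yes t′<d = let t<d , i≤ , j≤ = below t′<d in
      subst₂ _≤_ (sym (diagonal-lookup t′<d)) (sym (diagonal-lookup t<d))
                 (rpp _ _ _ _ (box∈Fer t′<d) (box∈Fer t<d) i≤ j≤)
    ... | no  t′≮d = subst (_≤ diagonal k ‼ suc t)
                           (sym (positivePrefix-beyond (values k′) (A k′ ⊓ B k′) (≮⇒≥ t′≮d))) z≤n

    diagonal-edge : k ≤ N → StorableEdge (R (suc k)) (diagonal k) (diagonal (suc k))
    diagonal-edge {k} k≤N = by-step (step k≤N)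
      where
      by-step : ∀ {b} → Step k b → StorableEdge b (diagonal k) (diagonal (suc k))
      by-step (R-step A-stays B-drops) (suc t) _ =
        diagonal-≤ (subst₂ (λ a b → Box≤ a (B (suc k)) t (A k) b t) (sym A-stays) (sym B-drops)
                           (Box≤-left (A k) (B (suc k)) t)) ,
        diagonal-≤ (subst₂ (λ b a → Box≤ (A k) b (suc t) a (B (suc k)) t) (sym B-drops) (sym A-stays)
                           (Box≤-up-deeper (A k) (B (suc k)) t))
      by-step (L-step A-rises B-stays) (suc t) _ =
        diagonal-≤ (subst₂ (λ a b → Box≤ (A k) (B k) t a b t) (sym A-rises) (sym B-stays)
                           (Box≤-up (A k) (B k) t)) ,
        diagonal-≤ (subst₂ (λ a b → Box≤ a b (suc t) (A k) (B k) t) (sym A-rises) (sym B-stays)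
                           (Box≤-left-deeper (A k) (B k) t))

    π : Vec (List ℕ) N
    π = fromComps diagonal N

    comp-π : k ≤ suc N → comp π k ≡ diagonal k
    comp-π {zero}  _   = refl
    comp-π {suc k} k<N with m≤n⇒m<n∨m≡n k<N
    ... | inj₁ k+1<N+1 = comp-fromComps diagonal N (s≤s z≤n) (s≤s⁻¹ k+1<N+1)
    ... | inj₂ refl    = trans (comp-last π) (sym (cong (positivePrefix (values (suc N))) d≡0))
      where
      d≡0 : A (suc N) ⊓ B (suc N) ≡ 0
      d≡0 = trans (cong (A (suc N) ⊓_) (B-vanishes ≤-refl)) (⊓-zeroʳ (A (suc N)))

    π-IsPartition : All IsPartition (toList π)
    π-IsPartition = fromComps-All diagonal N λ k _ _ →
      positivePrefix-IsPartition (values k) (A k ⊓ B k) (values-antitone k)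

    π-StorableAlong : StorableAlong π
    π-StorableAlong k k≤N = subst₂ (StorableEdge (R (suc k))) (sym (comp-π (≤-trans k≤N (n≤1+n N))))
                                   (sym (comp-π (s≤s k≤N))) (diagonal-edge k≤N)

    Φ-π-onDiagonal : k ≤ N → 1 ≤ i → 1 ≤ j → OnDiagonal k t i j → Φ π i j ≡ f i j
    Φ-π-onDiagonal {k} {i} {j} {t} k≤N i≥1 j≥1 on@(onDiagonal i+t≡A j+t≡B) = begin
      Φ π i j                ≡⟨ Φ-onDiagonal π i≥1 j≥1 on ⟩
      comp π k ‼ suc t       ≡⟨ cong (_‼ suc t) (comp-π (≤-trans k≤N (n≤1+n N))) ⟩
      diagonal k ‼ suc t     ≡⟨ diagonal-lookup (⊓-glb (subst (t <_) i+t≡A (m<n+m t i≥1))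
                                                       (subst (t <_) j+t≡B (m<n+m t j≥1))) ⟩
      f (A k ∸ t) (B k ∸ t)  ≡⟨ cong₂ f (subtract i+t≡A) (subtract j+t≡B) ⟩
      f i j                  ∎
      where
      open ≡-Reasoning
      subtract : ∀ {x y} → x + t ≡ y → y ∸ t ≡ x
      subtract {x} refl = m+n∸n≡m x t

    Φ-π : ∀ i j → InFer lam i j → Φ π i j ≡ f i j
    Φ-π i j fer@(i≥1 , _ , j≥1 , _) with ∈Fer⇒onDiagonal fer
    ... | k≤N , t , on = Φ-π-onDiagonal k≤N i≥1 j≥1 on

  Φ-surjective : ∀ f → IsRPP lam f →
    Σ (Vec (List ℕ) N) λ π →
      All IsPartition (toList π) × StorableAlong π × (∀ i j → InFer lam i j → Φ π i j ≡ f i j)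
  Φ-surjective f rpp = π , π-IsPartition , π-StorableAlong , Φ-π
    where open Diagonals f rpp

-- The lattice path of a permutation

inR-last : ∀ n c → inR n c (suc n) ≡ true
inR-last n c with n ≡ᵇ n in n≡n
... | true  = refl
... | false = ⊥-elim (subst T n≡n (≡⇒≡ᵇ n n refl))

inL≡not-inR : ∀ n (c : Permutation′ (suc (suc n))) {j} → 1 ≤ j → j ≤ suc (suc n) →
              inL (suc n) c j ≡ not (inR (suc n) c j)
inL≡not-inR n c {suc zero}    _ _  = refl
inL≡not-inR n c {suc (suc j)} _ j≤ with j <ᵇ n in j<n | j ≡ᵇ n in j≡n
... | true  | true  = contradiction (≡ᵇ⇒≡ j n (Equivalence.from T-≡ j≡n))
                                   (<⇒≢ (<ᵇ⇒< j n (Equivalence.from T-≡ j<n)))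
... | true  | false = sym (not-involutive _)
... | false | true  = refl
... | false | false with m≤n⇒m<n∨m≡n (s≤s⁻¹ (s≤s⁻¹ j≤))
...   | inj₁ j<n′ = ⊥-elim (subst T j<n (<⇒<ᵇ j<n′))
...   | inj₂ refl = ⊥-elim (subst T j≡n (≡⇒≡ᵇ j j refl))

-- Conditions (a)–(d) of c-storability at i, for x = [i ∈ L] and y = [i+1 ∈ R].
StorableCases : Bool → Bool → List ℕ → List ℕ → List ℕ → Set
StorableCases x y p₋ p p₊ =
  (x ≡ false → y ≡ false → Storable p₋ p × Storable p₊ p) ×
  (x ≡ false → y ≡ true  → Storable p₋ p × Storable p p₊) ×
  (x ≡ true  → y ≡ false → Storable p p₋ × Storable p₊ p) ×
  (x ≡ true  → y ≡ true  → Storable p p₋ × Storable p p₊)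

StorableCases⇒edges : ∀ x y {p₋ p p₊} → StorableCases x y p₋ p p₊ →
                      StorableEdge (not x) p₋ p × StorableEdge y p p₊
StorableCases⇒edges false false (st , _ , _ , _) = st refl refl
StorableCases⇒edges false true  (_ , st , _ , _) = st refl refl
StorableCases⇒edges true  false (_ , _ , st , _) = st refl refl
StorableCases⇒edges true  true  (_ , _ , _ , st) = st refl refl

edges⇒StorableCases : ∀ x y {p₋ p p₊} → StorableEdge (not x) p₋ p → StorableEdge y p p₊ →
                      StorableCases x y p₋ p p₊
edges⇒StorableCases false false e₋ e₊ = (λ _ _ → e₋ , e₊) , (λ _ ()) , (λ ()) , (λ ())
edges⇒StorableCases false true  e₋ e₊ = (λ _ ()) , (λ _ _ → e₋ , e₊) , (λ ()) , (λ ())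
edges⇒StorableCases true  false e₋ e₊ = (λ ()) , (λ ()) , (λ _ _ → e₋ , e₊) , (λ _ ())
edges⇒StorableCases true  true  e₋ e₊ = (λ ()) , (λ ()) , (λ _ ()) , (λ _ _ → e₋ , e₊)

module PermutationPath (n : ℕ) (c : Permutation′ (suc (suc n))) where

  open LatticePath (suc n) (inL (suc n) c) (inR (suc n) c) refl (inR-last (suc n) c) (inL≡not-inR n c) public

  CStorable⇒StorableAlong : ∀ {π} → CStorable (suc n) c π → StorableAlong π
  CStorable⇒StorableAlong {π} (_ , cases , _) zero _ =
    proj₁ (StorableCases⇒edges _ _ {comp π 0} {comp π 1} {comp π 2} (cases 1 ≤-refl (s≤s z≤n)))
  CStorable⇒StorableAlong {π} (_ , cases , _) (suc k) k<N =
    proj₂ (StorableCases⇒edges _ _ {comp π k} {comp π (suc k)} {comp π (suc (suc k))}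
                               (cases (suc k) (s≤s z≤n) k<N))

  StorableAlong⇒CStorable : ∀ {π} → All IsPartition (toList π) → StorableAlong π → CStorable (suc n) c π
  StorableAlong⇒CStorable {π} parts storable = parts , cases , outside
    where
    cases : ∀ i → 1 ≤ i → i ≤ suc n →
            StorableCases (inL (suc n) c i) (inR (suc n) c (suc i)) (comp π (i ∸ 1)) (comp π i) (comp π (suc i))
    cases (suc i) _ i<N = edges⇒StorableCases _ _
      (subst (λ b → StorableEdge b (comp π i) (comp π (suc i)))
             (sym (trans (cong not (inL≡not-inR n c (s≤s z≤n) (≤-trans i<N (n≤1+n _)))) (not-involutive _)))
             (storable i (≤-trans (n≤1+n i) i<N)))
      (storable (suc i) i<N)
    N+1≤maxR : suc (suc n) ≤ maxR (suc n) c
    N+1≤maxR = ∈⇒≤foldr-⊔ (∈-filter⁺ (T? ∘ inR (suc n) c) (∈-applyUpTo⁺ suc ≤-refl)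
                                    (Equivalence.from T-≡ (inR-last (suc n) c)))
    outside : ∀ k → 1 ≤ k → k ≤ suc n → ¬ (minL (suc n) c ≤ k × k ≤ maxR (suc n) c) → comp π k ≡ []
    outside k k≥1 k≤N not-between =
      contradiction (≤-trans (m⊓n≤m 1 _) k≥1 , ≤-trans (≤-trans k≤N (n≤1+n _)) N+1≤maxR) not-between

theorem4p11 : (n : ℕ) → 1 ≤ n → (c : Permutation′ (suc n)) → IsCoxeter n c →
    ((π : Vec (List ℕ) n) → CStorable n c π → IsRPP (lamC n c) (Phi n c π)) ×
    ((π π′ : Vec (List ℕ) n) → CStorable n c π → CStorable n c π′ →
      (∀ i j → InFer (lamC n c) i j → Phi n c π i j ≡ Phi n c π′ i j) → π ≡ π′) ×
    ((f : ℕ → ℕ → ℕ) → IsRPP (lamC n c) f →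
      Σ (Vec (List ℕ) n) (λ π → CStorable n c π ×
        (∀ i j → InFer (lamC n c) i j → Phi n c π i j ≡ f i j)))
theorem4p11 zero    () c _
theorem4p11 (suc n) _  c _ =
    (λ π st → Φ-IsRPP (CStorable⇒StorableAlong st))
  , (λ π π′ st st′ →
       Φ-injective (proj₁ st) (proj₁ st′) (CStorable⇒StorableAlong st) (CStorable⇒StorableAlong st′))
  , (λ f rpp → let π , parts , storable , Φπ≡f = Φ-surjective f rpp in
               π , StorableAlong⇒CStorable parts storable , Φπ≡f)
  where open PermutationPath n c
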